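{- For every finite string $W$ in the letters $A,B,X$, one has $|W|=|[XW]|-|[AXW]|$ in the tight puzzle.
   Context: Tight puzzle: words with (coefficient, weight) $X$ $(1,0)$; $XA$ $(1,1)$; $XAA$ $(1,1)$; $AXA$ $(2,1)$; $AAA$ $(-1,1)$; $BA$ $(-1,1)$; $ABA$ $(-1,1)$; $XXA$ $(-1,1)$. A parsing is a decomposition of a string into consecutive words from this list, in which the word $X$ is never immediately followed by the word $XA$ nor by the word $BA$. $|W|$ is the value of the open sentence $W$: the bi-infinite string obtained by padding $W$ on both sides with infinitely many $X$'s, parsed as a whole. For a finite string $U$, the locked string $[U]$ has as parsings only the decompositions of the finite string $U$ itself into words (no padding $X$'s are used). For any of these, coefficient of a parsing = product of coefficients of its words, weight = sum of weights; $c(S,w)$ = sum of coefficients of weight-$w$ parsings; $|S|=\sum_{w\ge0}c(S,w)t^w$. -}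

module Defs where

open import Data.Nat using (ℕ; zero; suc; _≡ᵇ_)
open import Data.Integer using (ℤ; +_; -_; _*_; _+_; _-_)
open import Data.Bool using (Bool; true; false; if_then_else_; _∧_; not)
open import Data.List using (List; []; _∷_; _++_; map; concatMap; length; replicate; filter; foldr; [_])
open import Data.Maybe using (Maybe; just; nothing)
open import Relation.Binary.PropositionalEquality using (_≡_)

data Letter : Set where
  A B X : Letter

_==L_ : Letter → Letter → Bool
A ==L A = true
B ==L B = true
X ==L X = true
_ ==L _ = false

data Word : Set where
  wX wXA wXAA wAXA wAAA wBA wABA wXXA : Word

allWords : List Word
allWords = wX ∷ wXA ∷ wXAA ∷ wAXA ∷ wAAA ∷ wBA ∷ wABA ∷ wXXA ∷ []

spell : Word → List Letter
spell wX   = X ∷ []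
spell wXA  = X ∷ A ∷ []
spell wXAA = X ∷ A ∷ A ∷ []
spell wAXA = A ∷ X ∷ A ∷ []
spell wAAA = A ∷ A ∷ A ∷ []
spell wBA  = B ∷ A ∷ []
spell wABA = A ∷ B ∷ A ∷ []
spell wXXA = X ∷ X ∷ A ∷ []

coef : Word → ℤ
coef wX   = + 1
coef wXA  = + 1
coef wXAA = + 1
coef wAXA = + 2
coef wAAA = - (+ 1)
coef wBA  = - (+ 1)
coef wABA = - (+ 1)
coef wXXA = - (+ 1)

weight : Word → ℕ
weight wX = 0
weight _  = 1

dropPrefix : List Letter → List Letter → Maybe (List Letter)
dropPrefix [] u = just u
dropPrefix (a ∷ p) [] = nothing
dropPrefix (a ∷ p) (b ∷ u) = if a ==L b then dropPrefix p u else nothing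

-- All lists of words whose concatenation is u (fuel n ≥ length u suffices,
-- since every word is nonempty).
decompF : ℕ → List Letter → List (List Word)
decompF _ [] = [] ∷ []
decompF zero (_ ∷ _) = []
decompF (suc n) u = concatMap step allWords
  where
  step : Word → List (List Word)
  step w with dropPrefix (spell w) u
  ... | nothing = []
  ... | just v  = map (w ∷_) (decompF n v)

decompositions : List Letter → List (List Word)
decompositions u = decompF (length u) u

forbidden : Word → Word → Bool
forbidden wX wXA = true
forbidden wX wBA = true
forbidden _ _ = false

admissibleAfter : Maybe Word → List Word → Bool
admissibleAfter _ [] = true
admissibleAfter nothing (w ∷ ws) = admissibleAfter (just w) ws
admissibleAfter (just p) (w ∷ ws) = not (forbidden p w) ∧ admissibleAfter (just w) ws

coefP : List Word → ℤ
coefP ws = foldr (λ w c → coef w * c) (+ 1) ws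

weightP : List Word → ℕ
weightP ws = foldr (λ w n → Data.Nat._+_ (weight w) n) 0 ws

cSum : List (List Word) → ℕ → ℤ
cSum [] w = + 0
cSum (p ∷ ps) w = (if weightP p ≡ᵇ w then coefP p else + 0) + cSum ps w

-- Locked strings [U]: parsings are the admissible decompositions of U.

lockedParsings : List Letter → List (List Word)
lockedParsings u = filter (λ ws → Data.Bool._≟_ (admissibleAfter nothing ws) true) (decompositions u)

cLocked : List Letter → ℕ → ℤ
cLocked u w = cSum (lockedParsings u) w

-- Open sentences W: parsings of the bi-infinite string X^∞ W X^∞.
-- Every word other than X contains an A and ends with A, so in any parsing
-- of X^∞ W X^∞ all words outside the window X³ W X³ are copies of the word X,
-- and no word straddles the window boundary.  Hence the parsings of the
-- open sentence correspond exactly to the decompositions of the window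
-- X³ W X³ that are admissible given that the preceding word is X (the
-- following word being X imposes no constraint).  Outside words X have
-- coefficient 1 and weight 0.

pad : ℕ
pad = 3

openWindow : List Letter → List Letter
openWindow W = replicate pad X ++ W ++ replicate pad X

openParsings : List Letter → List (List Word)
openParsings W = filter (λ ws → Data.Bool._≟_ (admissibleAfter (just wX) ws) true) (decompositions (openWindow W))

cOpen : List Letter → ℕ → ℤ
cOpen W w = cSum (openParsings W) w

-- Expand parsings by their first word.  Every word other than X ends in A,
-- so trailing X's can only be parsed as copies of X and may be dropped: the
-- open sentence W counts the parsings of XXXW that follow a word X.  No word
-- other than X constrains its successor, so after such a word only the
-- locked count of the remainder matters.  Peeling the three leading X's
-- leaves the parsings of W after X, those starting with XAA or XXA at the
-- last X, and those starting with XXA at the middle X; expanding [XW] and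
-- [AXW] in the same way gives the same terms, except that the XXA at the
-- middle X is replaced by XA minus AXA, and these agree because the three
-- words consume the same letters, have weight 1, and -1 = 1 - 2.
module Submission where

open import Defs
open import Data.Nat using (ℕ; zero; suc; _≤_; _<_; s≤s; _≡ᵇ_)
import Data.Nat as ℕ
open import Data.Nat.Properties using (≤-refl; ≤-trans; ≤-pred; ≤-reflexive; m≤n⇒m≤1+n; +-comm)
open import Data.Integer using (ℤ; +_; _*_; _+_; _-_; +0)
open import Data.Integer.Properties using (*-zeroʳ; *-distribˡ-+; +-identityˡ; +-assoc)
open import Data.Integer.Tactic.RingSolver using (solve-∀)
open import Data.Bool using (Bool; true; false; if_then_else_; not; _∧_; _≟_)
open import Data.List using (List; []; _∷_; _++_; _∷ʳ_; map; concatMap; length; replicate; filter)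
open import Data.List.Properties using (filter-++; filter-≐; length-++; ++-identityʳ; ∷ʳ-++)
open import Data.Maybe using (Maybe; just; nothing)
import Data.Maybe as Maybe
open import Data.Product using (_,_)
open import Relation.Unary using (Decidable)
open import Relation.Binary.PropositionalEquality
  using (_≡_; _≗_; refl; sym; trans; cong; cong₂; module ≡-Reasoning)

open ≡-Reasoning

Series : Set
Series = ℕ → ℤ

mulMonomial : ℤ → ℕ → Series → Series
mulMonomial c zero    f n       = c * f n
mulMonomial c (suc k) f zero    = +0
mulMonomial c (suc k) f (suc n) = mulMonomial c k f n

mulMonomial-cong : ∀ c k {f g} → f ≗ g → mulMonomial c k f ≗ mulMonomial c k g
mulMonomial-cong c zero    f≗g n       = cong (c *_) (f≗g n)
mulMonomial-cong c (suc k) f≗g zero    = refl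
mulMonomial-cong c (suc k) f≗g (suc n) = mulMonomial-cong c k f≗g n

mulMonomial-zero : ∀ c k → mulMonomial c k (λ _ → +0) ≗ (λ _ → +0)
mulMonomial-zero c zero    n       = *-zeroʳ c
mulMonomial-zero c (suc k) zero    = refl
mulMonomial-zero c (suc k) (suc n) = mulMonomial-zero c k n

mulMonomial-+ : ∀ c k (f g : Series) n →
  mulMonomial c k (λ m → f m + g m) n ≡ mulMonomial c k f n + mulMonomial c k g n
mulMonomial-+ c zero    f g n       = *-distribˡ-+ c (f n) (g n)
mulMonomial-+ c (suc k) f g zero    = refl
mulMonomial-+ c (suc k) f g (suc n) = mulMonomial-+ c k f g n

mulMonomial-- : ∀ c d k (f : Series) n →
  mulMonomial (c - d) k f n ≡ mulMonomial c k f n - mulMonomial d k f n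
mulMonomial-- c d zero    f n       = distrib c d (f n)
  where
  distrib : ∀ c d x → (c - d) * x ≡ c * x - d * x
  distrib = solve-∀
mulMonomial-- c d (suc k) f zero    = refl
mulMonomial-- c d (suc k) f (suc n) = mulMonomial-- c d k f n

mulMonomial-indicator : ∀ c k x e n →
  (if k ℕ.+ x ≡ᵇ n then c * e else +0) ≡ mulMonomial c k (λ m → if x ≡ᵇ m then e else +0) n
mulMonomial-indicator c zero    x e n with x ≡ᵇ n
... | true  = refl
... | false = sym (*-zeroʳ c)
mulMonomial-indicator c (suc k) x e zero    = refl
mulMonomial-indicator c (suc k) x e (suc n) = mulMonomial-indicator c k x e n

prependWord : Word → Series → Series
prependWord w = mulMonomial (coef w) (weight w)

cSum-++ : ∀ ps qs n → cSum (ps ++ qs) n ≡ cSum ps n + cSum qs n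
cSum-++ []       qs n = sym (+-identityˡ (cSum qs n))
cSum-++ (p ∷ ps) qs n = trans (cong (λ z → term + z) (cSum-++ ps qs n)) (sym (+-assoc term (cSum ps n) (cSum qs n)))
  where
  term : ℤ
  term = if weightP p ≡ᵇ n then coefP p else +0

cSum-map-∷ : ∀ w ps n → cSum (map (w ∷_) ps) n ≡ prependWord w (cSum ps) n
cSum-map-∷ w []       n = sym (mulMonomial-zero (coef w) (weight w) n)
cSum-map-∷ w (p ∷ ps) n = begin
  (if weight w ℕ.+ weightP p ≡ᵇ n then coef w * coefP p else +0) + cSum (map (w ∷_) ps) n
    ≡⟨ cong₂ _+_ (mulMonomial-indicator (coef w) (weight w) (weightP p) (coefP p) n) (cSum-map-∷ w ps n) ⟩
  prependWord w (λ m → if weightP p ≡ᵇ m then coefP p else +0) n + prependWord w (cSum ps) n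
    ≡⟨ mulMonomial-+ (coef w) (weight w) _ (cSum ps) n ⟨
  prependWord w (cSum (p ∷ ps)) n ∎

sumOver : {A : Set} → List A → (A → ℤ) → ℤ
sumOver []       g = +0
sumOver (x ∷ xs) g = g x + sumOver xs g

sumOver-cong : {A : Set} (xs : List A) {g h : A → ℤ} → g ≗ h → sumOver xs g ≡ sumOver xs h
sumOver-cong []       g≗h = refl
sumOver-cong (x ∷ xs) g≗h = cong₂ _+_ (g≗h x) (sumOver-cong xs g≗h)

admissible? : ∀ p → Decidable (λ ws → admissibleAfter p ws ≡ true)
admissible? p ws = admissibleAfter p ws ≟ true

forbiddenAfter : Maybe Word → Word → Bool
forbiddenAfter nothing  w = false
forbiddenAfter (just q) w = forbidden q w

admissibleAfter-∷ : ∀ p w ws → admissibleAfter p (w ∷ ws) ≡ not (forbiddenAfter p w) ∧ admissibleAfter (just w) ws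
admissibleAfter-∷ nothing  w ws = refl
admissibleAfter-∷ (just q) w ws = refl

filter-admissible-map-∷ : ∀ p w ds →
  filter (admissible? p) (map (w ∷_) ds)
    ≡ (if forbiddenAfter p w then [] else map (w ∷_) (filter (admissible? (just w)) ds))
filter-admissible-map-∷ p w [] with forbiddenAfter p w
... | true  = refl
... | false = refl
filter-admissible-map-∷ p w (ws ∷ ds)
  rewrite admissibleAfter-∷ p w ws with forbiddenAfter p w | filter-admissible-map-∷ p w ds
... | true  | ih = ih
... | false | ih with admissibleAfter (just w) ws
...   | true  = cong ((w ∷ ws) ∷_) ih
...   | false = ih

cSum-filter-concatMap : ∀ {P : List Word → Set} (P? : Decidable P) (xs : List Word) f n →
  cSum (filter P? (concatMap f xs)) n ≡ sumOver xs (λ x → cSum (filter P? (f x)) n)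
cSum-filter-concatMap P? []       f n = refl
cSum-filter-concatMap P? (x ∷ xs) f n = begin
  cSum (filter P? (f x ++ concatMap f xs)) n
    ≡⟨ cong (λ ds → cSum ds n) (filter-++ P? (f x) (concatMap f xs)) ⟩
  cSum (filter P? (f x) ++ filter P? (concatMap f xs)) n
    ≡⟨ cSum-++ (filter P? (f x)) _ n ⟩
  cSum (filter P? (f x)) n + cSum (filter P? (concatMap f xs)) n
    ≡⟨ cong (λ z → cSum (filter P? (f x)) n + z) (cSum-filter-concatMap P? xs f n) ⟩
  sumOver (x ∷ xs) (λ y → cSum (filter P? (f y)) n) ∎

decompStep : ℕ → Word → Maybe (List Letter) → List (List Word)
decompStep k w nothing  = []
decompStep k w (just v) = map (w ∷_) (decompF k v)

-- The inner step of decompF is a with-function, which reduces only once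
-- dropPrefix has read enough letters (at most three) to decide every word.
decompF-suc : ∀ k a u →
  decompF (suc k) (a ∷ u) ≡ concatMap (λ w → decompStep k w (dropPrefix (spell w) (a ∷ u))) allWords
decompF-suc k A []          = refl
decompF-suc k A (A ∷ [])    = refl
decompF-suc k A (B ∷ [])    = refl
decompF-suc k A (X ∷ [])    = refl
decompF-suc k A (A ∷ A ∷ u) = refl
decompF-suc k A (A ∷ B ∷ u) = refl
decompF-suc k A (A ∷ X ∷ u) = refl
decompF-suc k A (B ∷ A ∷ u) = refl
decompF-suc k A (B ∷ B ∷ u) = refl
decompF-suc k A (B ∷ X ∷ u) = refl
decompF-suc k A (X ∷ A ∷ u) = refl
decompF-suc k A (X ∷ B ∷ u) = refl
decompF-suc k A (X ∷ X ∷ u) = refl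
decompF-suc k B []          = refl
decompF-suc k B (A ∷ u)     = refl
decompF-suc k B (B ∷ u)     = refl
decompF-suc k B (X ∷ u)     = refl
decompF-suc k X []          = refl
decompF-suc k X (A ∷ [])    = refl
decompF-suc k X (A ∷ A ∷ u) = refl
decompF-suc k X (A ∷ B ∷ u) = refl
decompF-suc k X (A ∷ X ∷ u) = refl
decompF-suc k X (B ∷ u)     = refl
decompF-suc k X (X ∷ [])    = refl
decompF-suc k X (X ∷ A ∷ u) = refl
decompF-suc k X (X ∷ B ∷ u) = refl
decompF-suc k X (X ∷ X ∷ u) = refl

cAfterF : Maybe Word → ℕ → List Letter → Series
cAfterF p k u = cSum (filter (admissible? p) (decompF k u))

-- cLocked u = cAfter nothing u and cOpen W = cAfter (just wX) (openWindow W)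
-- hold by definition.
cAfter : Maybe Word → List Letter → Series
cAfter p u = cAfterF p (length u) u

afterFirstWord : Word → Maybe (List Letter) → (List Letter → Series) → Series
afterFirstWord w nothing  F n = +0
afterFirstWord w (just v) F n = prependWord w (F v) n

firstWordTerm : Maybe Word → Word → Maybe (List Letter) → (List Letter → Series) → Series
firstWordTerm p w m F n = if forbiddenAfter p w then +0 else afterFirstWord w m F n

expandFirst : Maybe Word → List Letter → (Word → List Letter → Series) → Series
expandFirst p u F n = sumOver allWords (λ w → firstWordTerm p w (dropPrefix (spell w) u) (F w) n)

cSum-filter-decompStep : ∀ p k w m n →
  cSum (filter (admissible? p) (decompStep k w m)) n ≡ firstWordTerm p w m (cAfterF (just w) k) n
cSum-filter-decompStep p k w nothing n with forbiddenAfter p w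
... | true  = refl
... | false = refl
cSum-filter-decompStep p k w (just v) n rewrite filter-admissible-map-∷ p w (decompF k v) with forbiddenAfter p w
... | true  = refl
... | false = cSum-map-∷ w (filter (admissible? (just w)) (decompF k v)) n

cAfterF-suc : ∀ p k a u → cAfterF p (suc k) (a ∷ u) ≗ expandFirst p (a ∷ u) (λ w → cAfterF (just w) k)
cAfterF-suc p k a u n = begin
  cSum (filter (admissible? p) (decompF (suc k) (a ∷ u))) n
    ≡⟨ cong (λ ds → cSum (filter (admissible? p) ds) n) (decompF-suc k a u) ⟩
  cSum (filter (admissible? p) (concatMap (λ w → decompStep k w (dropPrefix (spell w) (a ∷ u))) allWords)) n
    ≡⟨ cSum-filter-concatMap (admissible? p) allWords (λ w → decompStep k w (dropPrefix (spell w) (a ∷ u))) n ⟩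
  sumOver allWords (λ w → cSum (filter (admissible? p) (decompStep k w (dropPrefix (spell w) (a ∷ u)))) n)
    ≡⟨ sumOver-cong allWords (λ w → cSum-filter-decompStep p k w (dropPrefix (spell w) (a ∷ u)) n) ⟩
  expandFirst p (a ∷ u) (λ w → cAfterF (just w) k) n ∎

afterFirstWord-cong : ∀ w m {F G : List Letter → Series} →
  (∀ v → m ≡ just v → F v ≗ G v) → afterFirstWord w m F ≗ afterFirstWord w m G
afterFirstWord-cong w nothing  F≗G n = refl
afterFirstWord-cong w (just v) F≗G n = mulMonomial-cong (coef w) (weight w) (F≗G v refl) n

expandFirst-cong : ∀ p {u u'} {F G : Word → List Letter → Series} n →
  (∀ w → afterFirstWord w (dropPrefix (spell w) u) (F w) n ≡ afterFirstWord w (dropPrefix (spell w) u') (G w) n) →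
  expandFirst p u F n ≡ expandFirst p u' G n
expandFirst-cong p n eq = sumOver-cong allWords (λ w → cong (if forbiddenAfter p w then +0 else_) (eq w))

dropPrefix-≤ : ∀ p u {v} → dropPrefix p u ≡ just v → length v ≤ length u
dropPrefix-≤ []      u       refl = ≤-refl
dropPrefix-≤ (a ∷ p) []      ()
dropPrefix-≤ (a ∷ p) (b ∷ u) e with a ==L b
... | true  = m≤n⇒m≤1+n (dropPrefix-≤ p u e)
dropPrefix-≤ (a ∷ p) (b ∷ u) () | false

dropPrefix-< : ∀ a p {u v} → dropPrefix (a ∷ p) u ≡ just v → length v < length u
dropPrefix-< a p {[]}    ()
dropPrefix-< a p {b ∷ u} e with a ==L b
... | true  = s≤s (dropPrefix-≤ p u e)
dropPrefix-< a p {b ∷ u} () | false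

dropPrefix-spell-< : ∀ w {u v} → dropPrefix (spell w) u ≡ just v → length v < length u
dropPrefix-spell-< wX   {u} = dropPrefix-< X [] {u}
dropPrefix-spell-< wXA  {u} = dropPrefix-< X (A ∷ []) {u}
dropPrefix-spell-< wXAA {u} = dropPrefix-< X (A ∷ A ∷ []) {u}
dropPrefix-spell-< wAXA {u} = dropPrefix-< A (X ∷ A ∷ []) {u}
dropPrefix-spell-< wAAA {u} = dropPrefix-< A (A ∷ A ∷ []) {u}
dropPrefix-spell-< wBA  {u} = dropPrefix-< B (A ∷ []) {u}
dropPrefix-spell-< wABA {u} = dropPrefix-< A (B ∷ A ∷ []) {u}
dropPrefix-spell-< wXXA {u} = dropPrefix-< X (X ∷ A ∷ []) {u}

dropPrefix-spell-≤ : ∀ w {a u v k} → dropPrefix (spell w) (a ∷ u) ≡ just v → length u ≤ k → length v ≤ k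
dropPrefix-spell-≤ w e u≤k = ≤-trans (≤-pred (dropPrefix-spell-< w e)) u≤k

cAfterF-fuel-irrelevant : ∀ p u {k k'} → length u ≤ k → length u ≤ k' → cAfterF p k u ≗ cAfterF p k' u
cAfterF-fuel-irrelevant p []      _ _ n = refl
cAfterF-fuel-irrelevant p (a ∷ u) {suc k} {suc k'} (s≤s u≤k) (s≤s u≤k') n = begin
  cAfterF p (suc k) (a ∷ u) n                          ≡⟨ cAfterF-suc p k a u n ⟩
  expandFirst p (a ∷ u) (λ w → cAfterF (just w) k) n
    ≡⟨ expandFirst-cong p n (λ w → afterFirstWord-cong w (dropPrefix (spell w) (a ∷ u)) (λ v e →
         cAfterF-fuel-irrelevant (just w) v (dropPrefix-spell-≤ w e u≤k) (dropPrefix-spell-≤ w e u≤k')) n) ⟩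
  expandFirst p (a ∷ u) (λ w → cAfterF (just w) k') n  ≡⟨ cAfterF-suc p k' a u n ⟨
  cAfterF p (suc k') (a ∷ u) n                         ∎

cAfter-∷ : ∀ p a u → cAfter p (a ∷ u) ≗ expandFirst p (a ∷ u) (λ w → cAfter (just w))
cAfter-∷ p a u n = trans (cAfterF-suc p (length u) a u n)
  (expandFirst-cong p n (λ w → afterFirstWord-cong w (dropPrefix (spell w) (a ∷ u)) (λ v e →
    cAfterF-fuel-irrelevant (just w) v (dropPrefix-spell-≤ w e ≤-refl) ≤-refl) n))

dropPrefix-∷ʳA-[] : ∀ q → dropPrefix (q ∷ʳ A) [] ≡ nothing
dropPrefix-∷ʳA-[] []      = refl
dropPrefix-∷ʳA-[] (_ ∷ _) = refl

dropPrefix-∷ʳA-∷ʳX : ∀ q u → dropPrefix (q ∷ʳ A) (u ∷ʳ X) ≡ Maybe.map (_∷ʳ X) (dropPrefix (q ∷ʳ A) u)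
dropPrefix-∷ʳA-∷ʳX []      []      = refl
dropPrefix-∷ʳA-∷ʳX []      (A ∷ u) = refl
dropPrefix-∷ʳA-∷ʳX []      (B ∷ u) = refl
dropPrefix-∷ʳA-∷ʳX []      (X ∷ u) = refl
dropPrefix-∷ʳA-∷ʳX (c ∷ q) []      with c ==L X
... | true  = dropPrefix-∷ʳA-[] q
... | false = refl
dropPrefix-∷ʳA-∷ʳX (c ∷ q) (b ∷ u) with c ==L b
... | true  = dropPrefix-∷ʳA-∷ʳX q u
... | false = refl

dropPrefix-spell-∷ʳX : ∀ w a u →
  dropPrefix (spell w) ((a ∷ u) ∷ʳ X) ≡ Maybe.map (_∷ʳ X) (dropPrefix (spell w) (a ∷ u))
dropPrefix-spell-∷ʳX wX   A u = refl
dropPrefix-spell-∷ʳX wX   B u = refl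
dropPrefix-spell-∷ʳX wX   X u = refl
dropPrefix-spell-∷ʳX wXA  a u = dropPrefix-∷ʳA-∷ʳX (X ∷ []) (a ∷ u)
dropPrefix-spell-∷ʳX wXAA a u = dropPrefix-∷ʳA-∷ʳX (X ∷ A ∷ []) (a ∷ u)
dropPrefix-spell-∷ʳX wAXA a u = dropPrefix-∷ʳA-∷ʳX (A ∷ X ∷ []) (a ∷ u)
dropPrefix-spell-∷ʳX wAAA a u = dropPrefix-∷ʳA-∷ʳX (A ∷ A ∷ []) (a ∷ u)
dropPrefix-spell-∷ʳX wBA  a u = dropPrefix-∷ʳA-∷ʳX (B ∷ []) (a ∷ u)
dropPrefix-spell-∷ʳX wABA a u = dropPrefix-∷ʳA-∷ʳX (A ∷ B ∷ []) (a ∷ u)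
dropPrefix-spell-∷ʳX wXXA a u = dropPrefix-∷ʳA-∷ʳX (X ∷ X ∷ []) (a ∷ u)

cAfterF-∷ʳX : ∀ p k u → length u ≤ k → cAfterF p (suc k) (u ∷ʳ X) ≗ cAfterF p k u
cAfterF-∷ʳX nothing     k [] _ n = refl
cAfterF-∷ʳX (just wX)   k [] _ n = refl
cAfterF-∷ʳX (just wXA)  k [] _ n = refl
cAfterF-∷ʳX (just wXAA) k [] _ n = refl
cAfterF-∷ʳX (just wAXA) k [] _ n = refl
cAfterF-∷ʳX (just wAAA) k [] _ n = refl
cAfterF-∷ʳX (just wBA)  k [] _ n = refl
cAfterF-∷ʳX (just wABA) k [] _ n = refl
cAfterF-∷ʳX (just wXXA) k [] _ n = refl
cAfterF-∷ʳX p (suc k) (a ∷ u) (s≤s u≤k) n = begin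
  cAfterF p (suc (suc k)) ((a ∷ u) ∷ʳ X) n                  ≡⟨ cAfterF-suc p (suc k) a (u ∷ʳ X) n ⟩
  expandFirst p ((a ∷ u) ∷ʳ X) (λ w → cAfterF (just w) (suc k)) n ≡⟨ expandFirst-cong p n dropTrailingX ⟩
  expandFirst p (a ∷ u) (λ w → cAfterF (just w) k) n         ≡⟨ cAfterF-suc p k a u n ⟨
  cAfterF p (suc k) (a ∷ u) n                                ∎
  where
  dropTrailingX : ∀ w → afterFirstWord w (dropPrefix (spell w) ((a ∷ u) ∷ʳ X)) (cAfterF (just w) (suc k)) n
                      ≡ afterFirstWord w (dropPrefix (spell w) (a ∷ u)) (cAfterF (just w) k) n
  dropTrailingX w rewrite dropPrefix-spell-∷ʳX w a u with dropPrefix (spell w) (a ∷ u) in e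
  ... | nothing = refl
  ... | just v  = mulMonomial-cong (coef w) (weight w) (cAfterF-∷ʳX (just w) k v (dropPrefix-spell-≤ w e u≤k)) n

cAfter-∷ʳX : ∀ p u → cAfter p (u ∷ʳ X) ≗ cAfter p u
cAfter-∷ʳX p u n = trans
  (cAfterF-fuel-irrelevant p (u ∷ʳ X) ≤-refl (≤-reflexive (trans (length-++ u) (+-comm (length u) 1))) n)
  (cAfterF-∷ʳX p (length u) u ≤-refl n)

cAfter-++-Xs : ∀ p u j → cAfter p (u ++ replicate j X) ≗ cAfter p u
cAfter-++-Xs p u zero    n = cong (λ s → cAfter p s n) (++-identityʳ u)
cAfter-++-Xs p u (suc j) n = begin
  cAfter p (u ++ X ∷ replicate j X) n     ≡⟨ cong (λ s → cAfter p s n) (∷ʳ-++ u X (replicate j X)) ⟨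
  cAfter p ((u ∷ʳ X) ++ replicate j X) n  ≡⟨ cAfter-++-Xs p (u ∷ʳ X) j n ⟩
  cAfter p (u ∷ʳ X) n                     ≡⟨ cAfter-∷ʳX p u n ⟩
  cAfter p u n                            ∎

Unconstraining : Word → Set
Unconstraining w = ∀ w' → forbidden w w' ≡ false

admissibleAfter-unconstraining : ∀ {w} → Unconstraining w → ∀ ws → admissibleAfter (just w) ws ≡ admissibleAfter nothing ws
admissibleAfter-unconstraining free []        = refl
admissibleAfter-unconstraining free (w' ∷ ws) rewrite free w' = refl

cAfter-unconstraining : ∀ {w} → Unconstraining w → ∀ u → cAfter (just w) u ≗ cAfter nothing u
cAfter-unconstraining {w} free u n = cong (λ ds → cSum ds n)
  (filter-≐ (admissible? (just w)) (admissible? nothing)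
    ((λ {ws} adm → trans (sym (same ws)) adm) , (λ {ws} adm → trans (same ws) adm))
    (decompF (length u) u))
  where
  same : ∀ ws → admissibleAfter (just w) ws ≡ admissibleAfter nothing ws
  same = admissibleAfter-unconstraining free

startingWith : Word → List Letter → Series
startingWith w u = afterFirstWord w (dropPrefix (spell w) u) (cAfter (just w))

cAfter-wX-X∷ : ∀ u n → cAfter (just wX) (X ∷ u) n
  ≡ cAfter (just wX) u n + startingWith wXAA (X ∷ u) n + startingWith wXXA (X ∷ u) n
cAfter-wX-X∷ u n = trans (cAfter-∷ (just wX) X u n)
  (collect (cAfter (just wX) u n) (startingWith wXAA (X ∷ u) n) (startingWith wXXA (X ∷ u) n))
  where
  collect : ∀ y xaa xxa → + 1 * y + (+0 + (xaa + (+0 + (+0 + (+0 + (+0 + (xxa + +0))))))) ≡ y + xaa + xxa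
  collect = solve-∀

cAfter-X∷ : ∀ u n → cAfter nothing (X ∷ u) n
  ≡ cAfter (just wX) u n + startingWith wXA (X ∷ u) n + startingWith wXAA (X ∷ u) n + startingWith wXXA (X ∷ u) n
cAfter-X∷ u n = trans (cAfter-∷ nothing X u n)
  (collect (cAfter (just wX) u n) (startingWith wXA (X ∷ u) n) (startingWith wXAA (X ∷ u) n) (startingWith wXXA (X ∷ u) n))
  where
  collect : ∀ y xa xaa xxa → + 1 * y + (xa + (xaa + (+0 + (+0 + (+0 + (+0 + (xxa + +0))))))) ≡ y + xa + xaa + xxa
  collect = solve-∀

cAfter-A∷X∷ : ∀ u n → cAfter nothing (A ∷ X ∷ u) n ≡ startingWith wAXA (A ∷ X ∷ u) n
cAfter-A∷X∷ u n = trans (cAfter-∷ nothing A (X ∷ u) n) (collect (startingWith wAXA (A ∷ X ∷ u) n))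
  where
  collect : ∀ axa → +0 + (+0 + (+0 + (axa + (+0 + (+0 + (+0 + (+0 + +0))))))) ≡ axa
  collect = solve-∀

afterFirstWord-XXA : ∀ m n → afterFirstWord wXXA m (cAfter (just wXXA)) n
  ≡ afterFirstWord wXA m (cAfter (just wXA)) n - afterFirstWord wAXA m (cAfter (just wAXA)) n
afterFirstWord-XXA nothing  n = refl
afterFirstWord-XXA (just s) n = begin
  mulMonomial (+ 1 - + 2) 1 (cAfter (just wXXA) s) n
    ≡⟨ mulMonomial-cong (+ 1 - + 2) 1 (cAfter-unconstraining (λ _ → refl) s) n ⟩
  mulMonomial (+ 1 - + 2) 1 (cAfter nothing s) n
    ≡⟨ mulMonomial-- (+ 1) (+ 2) 1 (cAfter nothing s) n ⟩
  mulMonomial (+ 1) 1 (cAfter nothing s) n - mulMonomial (+ 2) 1 (cAfter nothing s) n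
    ≡⟨ cong₂ _-_ (mulMonomial-cong (+ 1) 1 (cAfter-unconstraining (λ _ → refl) s) n)
                 (mulMonomial-cong (+ 2) 1 (cAfter-unconstraining (λ _ → refl) s) n) ⟨
  mulMonomial (+ 1) 1 (cAfter (just wXA) s) n - mulMonomial (+ 2) 1 (cAfter (just wAXA) s) n ∎

startingWith-XXA : ∀ u n → startingWith wXXA (X ∷ X ∷ u) n ≡ startingWith wXA (X ∷ u) n - startingWith wAXA (A ∷ X ∷ u) n
startingWith-XXA u = afterFirstWord-XXA (dropPrefix (A ∷ []) u)

lemma4p9 : (W : List Letter) → (w : ℕ) →
    cOpen W w ≡ cLocked (X ∷ W) w - cLocked (A ∷ X ∷ W) w
lemma4p9 W n = begin
  cOpen W n                                   ≡⟨ cAfter-++-Xs (just wX) (X ∷ X ∷ X ∷ W) pad n ⟩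
  Y (X ∷ X ∷ X ∷ W) n                         ≡⟨ cAfter-wX-X∷ (X ∷ X ∷ W) n ⟩
  Y (X ∷ X ∷ W) n + +0 + +0                   ≡⟨ cong (λ z → z + +0 + +0) (cAfter-wX-X∷ (X ∷ W) n) ⟩
  Y (X ∷ W) n + +0 + xxa₂ + +0 + +0           ≡⟨ cong (λ z → z + +0 + xxa₂ + +0 + +0) (cAfter-wX-X∷ W n) ⟩
  Y W n + xaa + xxa + +0 + xxa₂ + +0 + +0     ≡⟨ cong (λ z → Y W n + xaa + xxa + +0 + z + +0 + +0) (startingWith-XXA W n) ⟩
  Y W n + xaa + xxa + +0 + (xa - axa) + +0 + +0 ≡⟨ rearrange (Y W n) xaa xxa xa axa ⟩
  Y W n + xa + xaa + xxa - axa                ≡⟨ cong₂ _-_ (cAfter-X∷ W n) (cAfter-A∷X∷ W n) ⟨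
  cLocked (X ∷ W) n - cLocked (A ∷ X ∷ W) n   ∎
  where
  Y : List Letter → Series
  Y = cAfter (just wX)
  xa xaa xxa xxa₂ axa : ℤ
  xa   = startingWith wXA (X ∷ W) n
  xaa  = startingWith wXAA (X ∷ W) n
  xxa  = startingWith wXXA (X ∷ W) n
  xxa₂ = startingWith wXXA (X ∷ X ∷ W) n
  axa  = startingWith wAXA (A ∷ X ∷ W) n
  rearrange : ∀ y a b c d → y + a + b + +0 + (c - d) + +0 + +0 ≡ y + c + a + b - d
  rearrange = solve-∀
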